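{- Let $G$ be a graph with component max-leaf $t$, and let $H$ be a connected subgraph of $G$. Then $|N_G(V(H))|\le t$.
   Context: For $S\subseteq V(G)$, $N_G(S)$ is the set of vertices of $V(G)\setminus S$ having a neighbour in $S$. The max-leaf of a connected graph is the maximum number of leaves of a spanning tree (the one-vertex graph counts as a tree with one leaf); the component max-leaf of $G$ is the maximum of the max-leaf over the connected components of $G$. -}

module Defs where

open import Data.Nat using (ℕ; _≤_; _≡ᵇ_)
open import Data.Bool using (Bool; true; false; _∧_; not; if_then_else_)
open import Data.Fin using (Fin)
open import Data.Fin.Subset using (Subset; ∣_∣)
open import Data.Vec using (lookup; tabulate)
open import Data.List using (List; []; _∷_; _++_; [_]; length; filterᵇ)
open import Data.List.Relation.Unary.Unique.Propositional using (Unique)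
open import Data.Bool.ListAction using (any)
open import Data.Unit using (⊤)
open import Data.Product using (Σ; _×_)
open import Relation.Nullary using (¬_)
open import Relation.Binary.PropositionalEquality using (_≡_)
import Data.List.Base as L

allV : (n : ℕ) → List (Fin n)
allV n = L.allFin n

count : ∀ {n} → (Fin n → Bool) → ℕ
count {n} f = length (filterᵇ f (allV n))

_∈V_ : ∀ {n} → Fin n → Subset n → Set
v ∈V S = lookup S v ≡ true

record Graph (n : ℕ) : Set where
  field
    adj    : Fin n → Fin n → Bool
    sym    : ∀ u v → adj u v ≡ adj v u
    irrefl : ∀ v → adj v v ≡ false
open Graph public

data Reach {n} (V : Subset n) (E : Fin n → Fin n → Bool) : Fin n → Fin n → Set where
  here : ∀ {u} → Reach V E u u
  step : ∀ {u w v} → E u w ≡ true → w ∈V V → Reach V E w v → Reach V E u v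

Connected : ∀ {n} → Subset n → (Fin n → Fin n → Bool) → Set
Connected {n} V E =
  (Σ (Fin n) λ v → v ∈V V) × (∀ u v → u ∈V V → v ∈V V → Reach V E u v)

record Subgraph {n} (G : Graph n) : Set where
  field
    V     : Subset n
    E     : Fin n → Fin n → Bool
    E-sym : ∀ u v → E u v ≡ E v u
    E⊆G   : ∀ u v → E u v ≡ true → adj G u v ≡ true
    E-in  : ∀ u v → E u v ≡ true → (u ∈V V) × (v ∈V V)
open Subgraph public

IsComponent : ∀ {n} → Graph n → Subset n → Set
IsComponent G C =
  Connected C (adj G) × (∀ u v → u ∈V C → adj G u v ≡ true → v ∈V C)

Chain : ∀ {n} → (Fin n → Fin n → Bool) → List (Fin n) → Set
Chain T [] = ⊤
Chain T (x ∷ []) = ⊤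
Chain T (x ∷ y ∷ r) = (T x y ≡ true) × Chain T (y ∷ r)

-- T contains a cycle x, ys..., z, x (at least 3 distinct vertices)
HasCycle : ∀ {n} → (Fin n → Fin n → Bool) → Set
HasCycle {n} T =
  Σ (Fin n) λ x → Σ (List (Fin n)) λ ys → Σ (Fin n) λ z →
    (1 ≤ length ys) × Unique (x ∷ ys ++ [ z ]) × Chain T (x ∷ ys ++ [ z ]) × (T z x ≡ true)

record SpanningTree {n} (C : Subset n) (E : Fin n → Fin n → Bool) : Set where
  field
    T     : Fin n → Fin n → Bool
    T-sym : ∀ u v → T u v ≡ T v u
    T⊆E   : ∀ u v → T u v ≡ true → E u v ≡ true
    T-in  : ∀ u v → T u v ≡ true → (u ∈V C) × (v ∈V C)
    T-conn : Connected C T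
    T-acyc : ¬ HasCycle T
open SpanningTree public

degree : ∀ {n} → (Fin n → Fin n → Bool) → Fin n → ℕ
degree T v = count (T v)

-- number of leaves (degree-1 vertices); a one-vertex tree has one leaf
leaves : ∀ {n} {C : Subset n} {E : Fin n → Fin n → Bool} → SpanningTree C E → ℕ
leaves {C = C} t =
  if ∣ C ∣ ≡ᵇ 1 then 1
  else count (λ v → lookup C v ∧ (degree (T t) v ≡ᵇ 1))

IsMaxLeaf : ∀ {n} → Subset n → (Fin n → Fin n → Bool) → ℕ → Set
IsMaxLeaf C E m =
  (Σ (SpanningTree C E) λ t → leaves t ≡ m) × (∀ (t : SpanningTree C E) → leaves t ≤ m)

IsComponentMaxLeaf : ∀ {n} → Graph n → ℕ → Set
IsComponentMaxLeaf {n} G t =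
  (Σ (Subset n) λ C → IsComponent G C × IsMaxLeaf C (adj G) t)
  × (∀ (C : Subset n) (m : ℕ) → IsComponent G C → IsMaxLeaf C (adj G) m → m ≤ t)

N : ∀ {n} → Graph n → Subset n → Subset n
N {n} G S = tabulate λ v →
  not (lookup S v) ∧ any (λ w → lookup S w ∧ adj G v w) (allV n)

-- Grow a tree from a vertex of H, first along the edges of H and the edges from V(H) into
-- N(V(H)): every vertex of N(V(H)) enters as a pendant vertex hung on H, and since later
-- attachments of this phase are all made at vertices of H, it stays a leaf.  Then keep growing
-- along arbitrary edges of G until the tree spans the component C of G containing H.
-- Attaching a pendant vertex never decreases the number of leaves (the new vertex is a leaf
-- and only its neighbour can stop being one), so this spanning tree of C has at least
-- |N(V(H))| leaves, hence so has a maximum-leaf spanning tree of C, which has at most t.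
-- That maximum exists only classically, so the bound is derived under double negation and
-- recovered by decidability of ≤.

module Submission where

open import Data.Bool using (Bool; true; false; _∧_; _∨_; not)
import Data.Bool as Bool
open import Data.Bool.ListAction using (any)
open import Data.Bool.Properties
  using (∧-conicalˡ; ∨-zeroʳ; ∨-identityʳ; T-≡; T-not-≡; T-∧; ⇔→≡)
open import Data.Empty using (⊥; ⊥-elim)
open import Data.Fin using (Fin; zero; suc; _≟_)
open import Data.Fin.Properties using (any?)
open import Data.Fin.Subset using (Subset; ∣_∣; _∈_; _⊆_; ⁅_⁆; inside; outside)
open import Data.Fin.Subset.Properties
  using (p⊆q⇒∣p∣≤∣q∣; p⊂q⇒∣p∣<∣q∣; ∣p∣≤n; ∣⁅x⁆∣≡1; x∈⁅x⁆; x∈⁅y⁆⇒x≡y)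
open import Data.List as L using ([]; _∷_; _++_; [_]; filterᵇ; length)
open import Data.List.Properties using (∷ʳ-injective; ++-assoc)
open import Data.List.Membership.Propositional using () renaming (_∈_ to _∈ˡ_)
import Data.List.Membership.DecPropositional as DecMembership
open import Data.List.Membership.Propositional.Properties using (∈-++⁺ʳ; ∈-++⁺ˡ)
import Data.List.Relation.Unary.Any as Any
open import Data.List.Relation.Unary.Any.Properties using (any⁻)
open import Data.List.Relation.Unary.All as All using (All)
open import Data.List.Relation.Unary.All.Properties using (¬Any⇒All¬)
open import Data.List.Relation.Unary.AllPairs using (_∷_)
open import Data.List.Relation.Unary.Unique.Propositional using (Unique)
open import Data.Nat using (ℕ; zero; suc; _+_; _≤_; _<_; z≤n; s≤s; _≡ᵇ_; _≤?_)
open import Data.Nat.Properties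
  using (module ≤-Reasoning; ≤-refl; ≤-reflexive; ≤-trans; ≤-antisym; <⇒≤; <⇒≱; ≮⇒≥; <-≤-trans;
         n≤1+n; m≤m+n; +-suc; +-monoʳ-≤; ≡ᵇ⇒≡)
open import Data.Product using (Σ; ∃; _×_; _,_; proj₁; proj₂; swap)
open import Data.Sum using (_⊎_; inj₁; inj₂; [_,_]′)
open import Data.Vec using (lookup; tabulate; _∷_; _[_]≔_)
open import Data.Vec.Properties
  using (lookup∘tabulate; tabulate∘lookup; tabulate-cong; lookup∘update; lookup∘update′;
         []=⇒lookup; lookup⇒[]=)
open import Function using (_∘_; mk⇔; Equivalence)
open import Relation.Nullary using (Dec; yes; no; ¬_; ⌊_⌋; _×-dec_; _⊎-dec_)
open import Relation.Nullary.Decidable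
  using (decidable-stable; toWitness; fromWitness; fromWitnessFalse)
open import Relation.Binary.PropositionalEquality hiding (sym; [_])
import Relation.Binary.PropositionalEquality as ≡

open import Defs

private
  variable
    n : ℕ

not-both : {b : Bool} → b ≡ true → b ≡ false → ⊥
not-both refl ()

_⊆ᵇ_ : (Fin n → Bool) → (Fin n → Bool) → Set
f ⊆ᵇ g = ∀ i → f i ≡ true → g i ≡ true

length-filterᵇ-tabulate : ∀ {m} {A : Set} (p : A → Bool) (g : Fin m → A) →
  length (filterᵇ p (L.tabulate g)) ≡ ∣ tabulate (λ i → p (g i)) ∣
length-filterᵇ-tabulate {zero} p g = refl
length-filterᵇ-tabulate {suc m} p g with p (g zero)
... | true  = cong suc (length-filterᵇ-tabulate p (λ i → g (suc i)))
... | false = length-filterᵇ-tabulate p (λ i → g (suc i))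

count≡∣tabulate∣ : (f : Fin n → Bool) → count f ≡ ∣ tabulate f ∣
count≡∣tabulate∣ f = length-filterᵇ-tabulate f (λ i → i)

∣p∣≡count : (p : Subset n) → ∣ p ∣ ≡ count (lookup p)
∣p∣≡count p = trans (cong ∣_∣ (≡.sym (tabulate∘lookup p))) (≡.sym (count≡∣tabulate∣ (lookup p)))

∈-tabulate⁺ : {f : Fin n → Bool} {i : Fin n} → f i ≡ true → i ∈ tabulate f
∈-tabulate⁺ {f = f} {i} fi = lookup⇒[]= i (tabulate f) (trans (lookup∘tabulate f i) fi)

∈-tabulate⁻ : {f : Fin n → Bool} {i : Fin n} → i ∈ tabulate f → f i ≡ true
∈-tabulate⁻ {f = f} {i} i∈ = trans (≡.sym (lookup∘tabulate f i)) ([]=⇒lookup i∈)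

tabulate-mono : {f g : Fin n → Bool} → f ⊆ᵇ g → tabulate f ⊆ tabulate g
tabulate-mono {g = g} f⊆g i∈ = ∈-tabulate⁺ {f = g} (f⊆g _ (∈-tabulate⁻ i∈))

count-mono : {f g : Fin n → Bool} → f ⊆ᵇ g → count f ≤ count g
count-mono {f = f} {g} f⊆g = begin
  count f          ≡⟨ count≡∣tabulate∣ f ⟩
  ∣ tabulate f ∣  ≤⟨ p⊆q⇒∣p∣≤∣q∣ (tabulate-mono f⊆g) ⟩
  ∣ tabulate g ∣  ≡⟨ count≡∣tabulate∣ g ⟨
  count g          ∎
  where open ≤-Reasoning

count-mono-< : {f g : Fin n → Bool} {i : Fin n} → f ⊆ᵇ g → f i ≡ false → g i ≡ true → count f < count g
count-mono-< {f = f} {g} {i} f⊆g fi gi = begin-strict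
  count f          ≡⟨ count≡∣tabulate∣ f ⟩
  ∣ tabulate f ∣  <⟨ p⊂q⇒∣p∣<∣q∣ (tabulate-mono f⊆g , i , ∈-tabulate⁺ {f = g} gi , i∉) ⟩
  ∣ tabulate g ∣  ≡⟨ count≡∣tabulate∣ g ⟨
  count g          ∎
  where
  open ≤-Reasoning
  i∉ : ¬ i ∈ tabulate f
  i∉ i∈ = not-both (∈-tabulate⁻ i∈) fi

count≤n : (f : Fin n → Bool) → count f ≤ n
count≤n f = subst (_≤ _) (≡.sym (count≡∣tabulate∣ f)) (∣p∣≤n (tabulate f))

count-cong : {f g : Fin n → Bool} → (∀ i → f i ≡ g i) → count f ≡ count g
count-cong {f = f} {g} f≗g = begin
  count f          ≡⟨ count≡∣tabulate∣ f ⟩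
  ∣ tabulate f ∣  ≡⟨ cong ∣_∣ (tabulate-cong f≗g) ⟩
  ∣ tabulate g ∣  ≡⟨ count≡∣tabulate∣ g ⟨
  count g          ∎
  where open ≡-Reasoning

count-unique : {f : Fin n → Bool} {u : Fin n} → f u ≡ true → (∀ i → f i ≡ true → i ≡ u) → count f ≡ 1
count-unique {f = f} {u} fu unique = begin
  count f          ≡⟨ count≡∣tabulate∣ f ⟩
  ∣ tabulate f ∣  ≡⟨ ≤-antisym (p⊆q⇒∣p∣≤∣q∣ f⊆⁅u⁆) (p⊆q⇒∣p∣≤∣q∣ ⁅u⁆⊆f) ⟩
  ∣ ⁅ u ⁆ ∣       ≡⟨ ∣⁅x⁆∣≡1 u ⟩
  1                ∎
  where
  open ≡-Reasoning
  f⊆⁅u⁆ : ∀ {i} → i ∈ tabulate f → i ∈ ⁅ u ⁆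
  f⊆⁅u⁆ {i} i∈ = subst (_∈ ⁅ u ⁆) (≡.sym (unique i (∈-tabulate⁻ i∈))) (x∈⁅x⁆ u)
  ⁅u⁆⊆f : ∀ {i} → i ∈ ⁅ u ⁆ → i ∈ tabulate f
  ⁅u⁆⊆f {i} i∈ = subst (_∈ tabulate f) (≡.sym (x∈⁅y⁆⇒x≡y u i∈)) (∈-tabulate⁺ {f = f} fu)

∣p∣≤1+∣p[x]≔outside∣ : (p : Subset n) (x : Fin n) → ∣ p ∣ ≤ suc ∣ p [ x ]≔ outside ∣
∣p∣≤1+∣p[x]≔outside∣ (inside  ∷ p) zero    = ≤-refl
∣p∣≤1+∣p[x]≔outside∣ (outside ∷ p) zero    = n≤1+n _
∣p∣≤1+∣p[x]≔outside∣ (inside  ∷ p) (suc x) = s≤s (∣p∣≤1+∣p[x]≔outside∣ p x)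
∣p∣≤1+∣p[x]≔outside∣ (outside ∷ p) (suc x) = ∣p∣≤1+∣p[x]≔outside∣ p x

count-exchange : {f g : Fin n → Bool} {u v : Fin n} →
  (∀ i → i ≢ u → f i ≡ true → g i ≡ true) → f v ≡ false → g v ≡ true → count f ≤ count g
count-exchange {n} {f} {g} {u} {v} f⊆g fv gv = begin
  count f                          ≡⟨ count≡∣tabulate∣ f ⟩
  ∣ tabulate f ∣                  ≤⟨ ∣p∣≤1+∣p[x]≔outside∣ (tabulate f) u ⟩
  suc ∣ tabulate f [ u ]≔ outside ∣ ≤⟨ p⊂q⇒∣p∣<∣q∣ (sub , v , ∈-tabulate⁺ {f = g} gv , v∉) ⟩
  ∣ tabulate g ∣                  ≡⟨ count≡∣tabulate∣ g ⟨
  count g                          ∎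
  where
  open ≤-Reasoning
  f-u : Subset n
  f-u = tabulate f [ u ]≔ outside
  ≢u : ∀ {i} → i ∈ f-u → i ≢ u
  ≢u i∈ refl = not-both ([]=⇒lookup i∈) (lookup∘update u (tabulate f) outside)
  ∈f : ∀ {i} → i ∈ f-u → f i ≡ true
  ∈f {i} i∈ = ∈-tabulate⁻ (lookup⇒[]= i (tabulate f)
    (trans (≡.sym (lookup∘update′ (≢u i∈) (tabulate f) outside)) ([]=⇒lookup i∈)))
  sub : f-u ⊆ tabulate g
  sub {i} i∈ = ∈-tabulate⁺ {f = g} (f⊆g i (≢u i∈) (∈f i∈))
  v∉ : ¬ v ∈ f-u
  v∉ v∈ = not-both (∈f v∈) fv

∨-true⁻ : {x y : Bool} → x ∨ y ≡ true → x ≡ true ⊎ y ≡ true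
∨-true⁻ {true}  _ = inj₁ refl
∨-true⁻ {false} e = inj₂ e

edge : Fin n → Fin n → Fin n → Fin n → Bool
edge u v a b = ⌊ (a ≟ u ×-dec b ≟ v) ⊎-dec (a ≟ v ×-dec b ≟ u) ⌋

module _ {u v : Fin n} where

  edge⁻ : {a b : Fin n} → edge u v a b ≡ true → (a ≡ u × b ≡ v) ⊎ (a ≡ v × b ≡ u)
  edge⁻ e = toWitness (Equivalence.from T-≡ e)

  edge⁺ : {a b : Fin n} → (a ≡ u × b ≡ v) ⊎ (a ≡ v × b ≡ u) → edge u v a b ≡ true
  edge⁺ p = Equivalence.to T-≡ (fromWitness p)

  edge-absent : {a b : Fin n} → ¬ ((a ≡ u × b ≡ v) ⊎ (a ≡ v × b ≡ u)) → edge u v a b ≡ false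
  edge-absent ¬p = Equivalence.to T-not-≡ (fromWitnessFalse ¬p)

  edge-sym : (a b : Fin n) → edge u v a b ≡ edge u v b a
  edge-sym a b = ⇔→≡ (mk⇔ (edge⁺ ∘ flip ∘ edge⁻) (edge⁺ ∘ flip ∘ edge⁻))
    where
    flip : ∀ {a b} → (a ≡ u × b ≡ v) ⊎ (a ≡ v × b ≡ u) → (b ≡ u × a ≡ v) ⊎ (b ≡ v × a ≡ u)
    flip = [ inj₂ ∘ swap , inj₁ ∘ swap ]′

withEdge : (Fin n → Fin n → Bool) → Fin n → Fin n → Fin n → Fin n → Bool
withEdge T u v a b = T a b ∨ edge u v a b

module _ {T : Fin n → Fin n → Bool} {u v : Fin n} where

  withEdge⁻ : {a b : Fin n} → withEdge T u v a b ≡ true →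
    T a b ≡ true ⊎ (a ≡ u × b ≡ v) ⊎ (a ≡ v × b ≡ u)
  withEdge⁻ e = [ inj₁ , inj₂ ∘ edge⁻ ]′ (∨-true⁻ e)

  withEdge-old : {a b : Fin n} → T a b ≡ true → withEdge T u v a b ≡ true
  withEdge-old {a} {b} e = cong (_∨ edge u v a b) e

  withEdge-new : {a b : Fin n} → (a ≡ u × b ≡ v) ⊎ (a ≡ v × b ≡ u) → withEdge T u v a b ≡ true
  withEdge-new {a} {b} e = trans (cong (T a b ∨_) (edge⁺ e)) (∨-zeroʳ _)

  withEdge-away : {a b : Fin n} → a ≢ u → a ≢ v → withEdge T u v a b ≡ T a b
  withEdge-away {a} {b} a≢u a≢v =
    trans (cong (T a b ∨_) (edge-absent [ a≢u ∘ proj₁ , a≢v ∘ proj₁ ]′)) (∨-identityʳ _)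

  withEdge-sym : (∀ a b → T a b ≡ T b a) → ∀ a b → withEdge T u v a b ≡ withEdge T u v b a
  withEdge-sym T-sym a b = cong₂ _∨_ (T-sym a b) (edge-sym a b)

chain-restrict : {R R′ : Fin n → Fin n → Bool} {P : Fin n → Set} →
  (∀ {a b} → P a → P b → R a b ≡ true → R′ a b ≡ true) →
  ∀ {l} → All P l → Chain R l → Chain R′ l
chain-restrict R⇒R′ {[]}          _                  _        = _
chain-restrict R⇒R′ {_ ∷ []}      _                  _        = _
chain-restrict R⇒R′ {_ ∷ _ ∷ _} (pa All.∷ pb All.∷ ps) (e , ch) =
  R⇒R′ pa pb e , chain-restrict R⇒R′ (pb All.∷ ps) ch

module _ {T : Fin n → Fin n → Bool} (T-sym : ∀ a b → T a b ≡ T b a)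
         {u v : Fin n} (pendant : ∀ y → T v y ≡ true → y ≡ u) where

  private
    pendant′ : ∀ y → T y v ≡ true → y ≡ u
    pendant′ y e = pendant y (trans (T-sym v y) e)

  pendant-last : ∀ a l → Unique (a ∷ l) → Chain T (a ∷ l) → v ∈ˡ l →
    ∃ λ p → a ∷ l ≡ p ++ u ∷ v ∷ []
  pendant-last a (_ ∷ [])    _           (av , _)      (Any.here refl) =
    [] , cong (_∷ v ∷ []) (pendant′ a av)
  pendant-last a (_ ∷ c ∷ l) (a∉ ∷ _)    (av , vc , _) (Any.here refl) =
    ⊥-elim (All.lookup a∉ (Any.there (Any.here refl)) (trans (pendant′ a av) (≡.sym (pendant c vc))))
  pendant-last a (b ∷ l)     (_ ∷ uq)   (_ , ch)      (Any.there v∈) =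
    let p , eq = pendant-last b l uq ch v∈ in a ∷ p , cong (a ∷_) eq

  -- If v = x, its two cycle neighbours are distinct yet both equal u.  Otherwise v is the
  -- last vertex z, preceded by u, and the closing edge z x forces x = u, a repeated vertex.
  pendant-off-cycle : ∀ {x ys z} → 1 ≤ length ys → Unique (x ∷ ys ++ [ z ]) →
    Chain T (x ∷ ys ++ [ z ]) → T z x ≡ true → ¬ v ∈ˡ x ∷ ys ++ [ z ]
  pendant-off-cycle {ys = y ∷ ys} {z} _ (_ ∷ y∉ ∷ _) (vy , _) zv (Any.here refl) =
    All.lookup y∉ (∈-++⁺ʳ ys (Any.here refl)) (trans (pendant y vy) (≡.sym (pendant′ z zv)))
  pendant-off-cycle {x} {ys} {z} len (x∉ ∷ uq) ch zx (Any.there v∈)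
    with p , eq ← pendant-last x (ys ++ [ z ]) (x∉ ∷ uq) ch v∈
    with init≡ , refl ← ∷ʳ-injective (x ∷ ys) (p ++ [ u ]) (trans eq (≡.sym (++-assoc p [ u ] [ v ])))
    with refl ← pendant x zx
    = x∉-ys p ys x∉ init≡ len
    where
    x∉-ys : ∀ p ys → All (x ≢_) (ys ++ [ z ]) → x ∷ ys ≡ p ++ [ x ] → 1 ≤ length ys → ⊥
    x∉-ys []      []      _   _    ()
    x∉-ys []      (_ ∷ _) _   ()
    x∉-ys (_ ∷ p) _       x∉ refl _ = All.lookup x∉ (∈-++⁺ˡ (∈-++⁺ʳ p (Any.here refl))) refl

module _ {T : Fin n → Fin n → Bool} (T-sym : ∀ a b → T a b ≡ T b a)
         {u v : Fin n} (u≢v : u ≢ v) (v-isolated : ∀ y → T v y ≡ false) where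

  withEdge-pendant : ∀ y → withEdge T u v v y ≡ true → y ≡ u
  withEdge-pendant y e with withEdge⁻ {T = T} e
  ... | inj₁ vy                = ⊥-elim (not-both vy (v-isolated y))
  ... | inj₂ (inj₁ (v≡u , _)) = ⊥-elim (u≢v (≡.sym v≡u))
  ... | inj₂ (inj₂ (_ , y≡u)) = y≡u

  degree-withEdge-new : degree (withEdge T u v) v ≡ 1
  degree-withEdge-new = count-unique (withEdge-new {T = T} (inj₂ (refl , refl))) withEdge-pendant

  withEdge-acyclic : ¬ HasCycle T → ¬ HasCycle (withEdge T u v)
  withEdge-acyclic acyclic (x , ys , z , len , uq , ch , zx)
    with DecMembership._∈?_ _≟_ v (x ∷ ys ++ [ z ])
  ... | yes v∈ = pendant-off-cycle (withEdge-sym T-sym) withEdge-pendant len uq ch zx v∈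
  ... | no  v∉ = acyclic (x , ys , z , len , uq , chain-restrict old avoids ch ,
                          old (All.lookup avoids (Any.there (∈-++⁺ʳ ys (Any.here refl))))
                              (All.lookup avoids (Any.here refl)) zx)
    where
    avoids : All (v ≢_) (x ∷ ys ++ [ z ])
    avoids = ¬Any⇒All¬ _ v∉
    old : ∀ {a b} → v ≢ a → v ≢ b → withEdge T u v a b ≡ true → T a b ≡ true
    old v≢a v≢b e with withEdge⁻ {T = T} e
    ... | inj₁ ab                = ab
    ... | inj₂ (inj₁ (_ , b≡v)) = ⊥-elim (v≢b (≡.sym b≡v))
    ... | inj₂ (inj₂ (a≡v , _)) = ⊥-elim (v≢a (≡.sym a≡v))

degree-withEdge-away : {T : Fin n → Fin n → Bool} {u v w : Fin n} → w ≢ u → w ≢ v →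
  degree (withEdge T u v) w ≡ degree T w
degree-withEdge-away {T = T} w≢u w≢v = count-cong (λ b → withEdge-away {T = T} {b = b} w≢u w≢v)

¬¬-argmax : {A : Set} (f : A → ℕ) (bound : ℕ) → (∀ x → f x ≤ bound) → A →
  ¬ ¬ (Σ A λ x → ∀ y → f y ≤ f x)
¬¬-argmax {A = A} f bound f≤bound x₀ = search bound x₀ (m≤m+n bound (f x₀))
  where
  search : ∀ k x → bound ≤ k + f x → ¬ ¬ (Σ A λ x → ∀ y → f y ≤ f x)
  search zero    x b refute = refute (x , λ y → ≤-trans (f≤bound y) b)
  search (suc k) x b refute = refute (x , λ y → ≮⇒≥ λ fx<fy →
    search k y (≤-trans b (≤-trans (≤-reflexive (≡.sym (+-suc k (f x)))) (+-monoʳ-≤ k fx<fy))) refute)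

isLeaf : Subset n → (Fin n → Fin n → Bool) → Fin n → Bool
isLeaf C T v = lookup C v ∧ (degree T v ≡ᵇ 1)

module _ {C : Subset n} {E : Fin n → Fin n → Bool} where

  leaves≤1+n : (t : SpanningTree C E) → leaves t ≤ suc n
  leaves≤1+n t with ∣ C ∣ ≡ᵇ 1
  ... | true  = s≤s z≤n
  ... | false = ≤-trans (count≤n _) (n≤1+n _)

  -- A one-vertex tree has 1 leaf by convention; there m < ∣ C ∣ = 1 forces m = 0.
  ≤-leaves : {m : ℕ} (t : SpanningTree C E) → m < ∣ C ∣ → m ≤ count (isLeaf C (T t)) → m ≤ leaves t
  ≤-leaves t m<∣C∣ m≤ with ∣ C ∣ ≡ᵇ 1 in ∣C∣≡ᵇ1
  ... | true  = <⇒≤ (subst (_ <_) (≡ᵇ⇒≡ ∣ C ∣ 1 (Equivalence.from T-≡ ∣C∣≡ᵇ1)) m<∣C∣)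
  ... | false = m≤

  ¬¬-IsMaxLeaf : SpanningTree C E → ¬ ¬ (∃ λ m → IsMaxLeaf C E m)
  ¬¬-IsMaxLeaf t refute = ¬¬-argmax leaves (suc n) leaves≤1+n t
    λ (t* , max) → refute (leaves t* , (t* , refl) , max)

Reach-map : {V V′ : Subset n} {E E′ : Fin n → Fin n → Bool} →
  (∀ w → w ∈V V → w ∈V V′) → (∀ a b → E a b ≡ true → E′ a b ≡ true) →
  ∀ {a b} → Reach V E a b → Reach V′ E′ a b
Reach-map V⊆V′ E⊆E′ here             = here
Reach-map V⊆V′ E⊆E′ (step e w∈ path) = step (E⊆E′ _ _ e) (V⊆V′ _ w∈) (Reach-map V⊆V′ E⊆E′ path)

Reach-trans : {V : Subset n} {E : Fin n → Fin n → Bool} {a b c : Fin n} →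
  Reach V E a b → Reach V E b c → Reach V E a c
Reach-trans here             path′ = path′
Reach-trans (step e w∈ path) path′ = step e w∈ (Reach-trans path path′)

Reach-closed : {V S : Subset n} {E : Fin n → Fin n → Bool} →
  (∀ {a b} → a ∈V S → E a b ≡ true → b ∈V S) → ∀ {a b} → a ∈V S → Reach V E a b → b ∈V S
Reach-closed closed a∈ here             = a∈
Reach-closed {S = S} closed a∈ (step e _ path) = Reach-closed {S = S} closed (closed a∈ e) path

∈N⁻ : {G : Graph n} {S : Subset n} {w : Fin n} → w ∈V N G S →
  lookup S w ≡ false × ∃ λ a → a ∈V S × adj G w a ≡ true
∈N⁻ {n} {G} {S} {w} w∈N with lookup S w | trans (≡.sym (lookup∘tabulate _ w)) w∈N
... | false | some-neighbour =
  let a , a∈∧wa = Any.satisfied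
        (any⁻ (λ a → lookup S a ∧ adj G w a) (allV n) (Equivalence.from T-≡ some-neighbour))
      a∈ , wa   = Equivalence.to T-∧ a∈∧wa
  in refl , a , Equivalence.to T-≡ a∈ , Equivalence.to T-≡ wa

record Subtree (G : Graph n) : Set where
  field
    vertices : Subset n
    tree     : SpanningTree vertices (adj G)
open Subtree

leafCount : {G : Graph n} → Subtree G → ℕ
leafCount P = count (isLeaf (vertices P) (T (tree P)))

∈V⁅⁆ : (h : Fin n) → h ∈V ⁅ h ⁆
∈V⁅⁆ h = []=⇒lookup (x∈⁅x⁆ h)

∈V⁅⁆⁻ : {h w : Fin n} → w ∈V ⁅ h ⁆ → w ≡ h
∈V⁅⁆⁻ {h = h} {w} w∈ = x∈⁅y⁆⇒x≡y h (lookup⇒[]= w ⁅ h ⁆ w∈)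

singleton : (G : Graph n) → Fin n → Subtree G
singleton G h = record
  { vertices = ⁅ h ⁆
  ; tree     = record
    { T      = λ _ _ → false
    ; T-sym  = λ _ _ → refl
    ; T⊆E    = λ _ _ ()
    ; T-in   = λ _ _ ()
    ; T-conn = (h , ∈V⁅⁆ h) , λ a b a∈ b∈ →
        subst₂ (Reach ⁅ h ⁆ _) (≡.sym (∈V⁅⁆⁻ {h = h} a∈)) (≡.sym (∈V⁅⁆⁻ {h = h} b∈)) here
    ; T-acyc = λ { (_ , _ , _ , _ , _ , _ , ()) }
    }
  }

module Attach {G : Graph n} (P : Subtree G) {u v : Fin n}
              (u∈ : u ∈V vertices P) (v∉ : lookup (vertices P) v ≡ false) (uv : adj G u v ≡ true) where

  private
    S  = vertices P
    T₀ = T (tree P)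

  S′ : Subset n
  S′ = S [ v ]≔ true

  T′ : Fin n → Fin n → Bool
  T′ = withEdge T₀ u v

  u≢v : u ≢ v
  u≢v refl = not-both u∈ v∉

  ∈⇒≢v : ∀ {w} → w ∈V S → w ≢ v
  ∈⇒≢v w∈ refl = not-both w∈ v∉

  v-isolated : ∀ y → T₀ v y ≡ false
  v-isolated y with T₀ v y in vy
  ... | true  = ⊥-elim (∈⇒≢v (proj₁ (T-in (tree P) v y vy)) refl)
  ... | false = refl

  ∈-new : v ∈V S′
  ∈-new = lookup∘update v S true

  lookup-old : ∀ {w} → w ≢ v → lookup S′ w ≡ lookup S w
  lookup-old w≢v = lookup∘update′ w≢v S true

  ∈-old : ∀ w → w ∈V S → w ∈V S′
  ∈-old w w∈ = trans (lookup-old (∈⇒≢v w∈)) w∈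

  ∈⁻ : ∀ {w} → w ∈V S′ → w ≡ v ⊎ w ∈V S
  ∈⁻ {w} w∈ with w ≟ v
  ... | yes w≡v = inj₁ w≡v
  ... | no  w≢v = inj₂ (trans (≡.sym (lookup-old w≢v)) w∈)

  T′-sym : ∀ a b → T′ a b ≡ T′ b a
  T′-sym = withEdge-sym (T-sym (tree P))

  T′⊆adj : ∀ a b → T′ a b ≡ true → adj G a b ≡ true
  T′⊆adj a b e with withEdge⁻ {T = T₀} e
  ... | inj₁ ab                = T⊆E (tree P) a b ab
  ... | inj₂ (inj₁ (refl , refl)) = uv
  ... | inj₂ (inj₂ (refl , refl)) = trans (sym G v u) uv

  T′-in : ∀ a b → T′ a b ≡ true → a ∈V S′ × b ∈V S′
  T′-in a b e with withEdge⁻ {T = T₀} e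
  ... | inj₁ ab                = let a∈ , b∈ = T-in (tree P) a b ab in ∈-old a a∈ , ∈-old b b∈
  ... | inj₂ (inj₁ (refl , refl)) = ∈-old u u∈ , ∈-new
  ... | inj₂ (inj₂ (refl , refl)) = ∈-new , ∈-old u u∈

  reach-old : ∀ a b → a ∈V S → b ∈V S → Reach S′ T′ a b
  reach-old a b a∈ b∈ =
    Reach-map ∈-old (λ _ _ → withEdge-old {T = T₀}) (proj₂ (T-conn (tree P)) a b a∈ b∈)

  T′-reach : ∀ a b → a ∈V S′ → b ∈V S′ → Reach S′ T′ a b
  T′-reach a b a∈ b∈ with ∈⁻ a∈ | ∈⁻ b∈
  ... | inj₁ refl | inj₁ refl = here
  ... | inj₁ refl | inj₂ b∈S  =
    step (withEdge-new {T = T₀} (inj₂ (refl , refl))) (∈-old u u∈) (reach-old u b u∈ b∈S)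
  ... | inj₂ a∈S  | inj₁ refl =
    Reach-trans (reach-old a u a∈S u∈) (step (withEdge-new {T = T₀} (inj₁ (refl , refl))) ∈-new here)
  ... | inj₂ a∈S  | inj₂ b∈S  = reach-old a b a∈S b∈S

  attach : Subtree G
  attach = record
    { vertices = S′
    ; tree     = record
      { T      = T′
      ; T-sym  = T′-sym
      ; T⊆E    = T′⊆adj
      ; T-in   = T′-in
      ; T-conn = (v , ∈-new) , T′-reach
      ; T-acyc = withEdge-acyclic (T-sym (tree P)) u≢v v-isolated (T-acyc (tree P))
      }
    }

  degree-new : degree T′ v ≡ 1
  degree-new = degree-withEdge-new (T-sym (tree P)) u≢v v-isolated

  degree-old : ∀ {w} → w ≢ u → w ≢ v → degree T′ w ≡ degree T₀ w
  degree-old = degree-withEdge-away {T = T₀}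

  vertexCount-< : count (lookup S) < count (lookup S′)
  vertexCount-< = count-mono-< ∈-old v∉ ∈-new

  leafCount-mono : leafCount P ≤ leafCount attach
  leafCount-mono = count-exchange {u = u} {v = v} old (cong (_∧ (degree T₀ v ≡ᵇ 1)) v∉) new
    where
    new : isLeaf S′ T′ v ≡ true
    new = cong₂ (λ b d → b ∧ (d ≡ᵇ 1)) ∈-new degree-new
    old : ∀ i → i ≢ u → isLeaf S T₀ i ≡ true → isLeaf S′ T′ i ≡ true
    old i i≢u leaf = trans (cong₂ (λ b d → b ∧ (d ≡ᵇ 1)) (lookup-old i≢v) (degree-old i≢u i≢v)) leaf
      where
      i≢v : i ≢ v
      i≢v = ∈⇒≢v (∧-conicalˡ _ _ leaf)

module Grow {G : Graph n} (R : Fin n → Fin n → Set) (R? : ∀ a b → Dec (R a b))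
            (R⇒adj : ∀ {a b} → R a b → adj G a b ≡ true) where

  Closed : Subset n → Set
  Closed S = ∀ {a b} → a ∈V S → R a b → b ∈V S

  Frontier : Subset n → Set
  Frontier S = ∃ λ a → ∃ λ b → a ∈V S × lookup S b ≡ false × R a b

  frontier? : (S : Subset n) → Dec (Frontier S)
  frontier? S = any? λ a → any? λ b →
    (lookup S a Bool.≟ true) ×-dec (lookup S b Bool.≟ false) ×-dec R? a b

  ¬Frontier⇒Closed : ∀ S → ¬ Frontier S → Closed S
  ¬Frontier⇒Closed S no-frontier {a} {b} a∈ r with lookup S b in b∈?
  ... | true  = refl
  ... | false = ⊥-elim (no-frontier (a , b , a∈ , b∈? , r))

  Preserved : (Subtree G → Set) → Set
  Preserved Inv = ∀ P {a b} (a∈ : a ∈V vertices P) (b∉ : lookup (vertices P) b ≡ false) (r : R a b) →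
    Inv P → Inv (Attach.attach P a∈ b∉ (R⇒adj r))

  record Closure (Inv : Subtree G → Set) (P : Subtree G) : Set where
    field
      subtree   : Subtree G
      invariant : Inv subtree
      closed    : Closed (vertices subtree)
      extends   : lookup (vertices P) ⊆ᵇ lookup (vertices subtree)

  closure : {Inv : Subtree G → Set} → Preserved Inv → (P : Subtree G) → Inv P → Closure Inv P
  closure {Inv} preserved P₀ = go n P₀ (m≤m+n n _)
    where
    go : ∀ k P → n ≤ k + count (lookup (vertices P)) → Inv P → Closure Inv P
    go k P bound inv with frontier? (vertices P)
    ... | no no-frontier = record
      { subtree = P ; invariant = inv ; closed = ¬Frontier⇒Closed (vertices P) no-frontier
      ; extends = λ _ w∈ → w∈ }
    go zero P bound inv | yes (a , b , a∈ , b∉ , r) =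
      ⊥-elim (<⇒≱ (<-≤-trans (Attach.vertexCount-< P a∈ b∉ (R⇒adj r)) (count≤n _)) bound)
    go (suc k) P bound inv | yes (a , b , a∈ , b∉ , r) = record
      { subtree = subtree ; invariant = invariant ; closed = closed
      ; extends = λ w w∈ → extends w (Attach.∈-old P a∈ b∉ (R⇒adj r) w w∈) }
      where
      P′ = Attach.attach P a∈ b∉ (R⇒adj r)
      bound′ : n ≤ k + count (lookup (vertices P′))
      bound′ = ≤-trans bound (≤-trans (≤-reflexive (≡.sym (+-suc k _)))
                 (+-monoʳ-≤ k (Attach.vertexCount-< P a∈ b∉ (R⇒adj r))))
      open Closure (go k P′ bound′ (preserved P a∈ b∉ r inv))

∈⇒∉N : {G : Graph n} {S : Subset n} {w : Fin n} → w ∈V S → lookup (N G S) w ≡ false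
∈⇒∉N {n} {G} {S} {w} w∈ =
  trans (lookup∘tabulate _ w) (cong (λ b → not b ∧ any (λ a → lookup S a ∧ adj G w a) (allV n)) w∈)

module _ (G : Graph n) (H : Subgraph G) (H-conn : Connected (V H) (E H)) where

  private
    NH = N G (V H)
    h  = proj₁ (proj₁ H-conn)
    h∈ = proj₂ (proj₁ H-conn)

  HOrBoundaryEdge : Fin n → Fin n → Set
  HOrBoundaryEdge a b = E H a b ≡ true ⊎ (a ∈V V H × b ∈V NH × adj G a b ≡ true)

  HOrBoundaryEdge? : ∀ a b → Dec (HOrBoundaryEdge a b)
  HOrBoundaryEdge? a b = (E H a b Bool.≟ true) ⊎-dec
    ((lookup (V H) a Bool.≟ true) ×-dec (lookup NH b Bool.≟ true) ×-dec (adj G a b Bool.≟ true))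

  HOrBoundaryEdge⇒adj : ∀ {a b} → HOrBoundaryEdge a b → adj G a b ≡ true
  HOrBoundaryEdge⇒adj = [ E⊆G H _ _ , proj₂ ∘ proj₂ ]′

  HOrBoundaryEdge-source : ∀ {a b} → HOrBoundaryEdge a b → a ∈V V H
  HOrBoundaryEdge-source = [ proj₁ ∘ E-in H _ _ , proj₁ ]′

  OutsideLeaves : Subtree G → Set
  OutsideLeaves P = ∀ w → w ∈V vertices P → lookup (V H) w ≡ false → degree (T (tree P)) w ≡ 1

  module Grow₁ = Grow {G = G} HOrBoundaryEdge HOrBoundaryEdge? HOrBoundaryEdge⇒adj
  module Grow₂ = Grow {G = G} (λ a b → adj G a b ≡ true) (λ a b → adj G a b Bool.≟ true) (λ ab → ab)

  outsideLeaves-preserved : Grow₁.Preserved OutsideLeaves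
  outsideLeaves-preserved P {a} {b} a∈ b∉ r inv w w∈ w∉H = [ new , old ]′ (A.∈⁻ w∈)
    where
    module A = Attach P a∈ b∉ (HOrBoundaryEdge⇒adj r)
    new : w ≡ b → degree A.T′ w ≡ 1
    new refl = [ (λ ab → ⊥-elim (not-both (proj₂ (E-in H a w ab)) w∉H)) , (λ _ → A.degree-new) ]′ r
    old : w ∈V vertices P → degree A.T′ w ≡ 1
    old w∈P = trans (A.degree-old w≢a (A.∈⇒≢v w∈P)) (inv w w∈P w∉H)
      where
      w≢a : w ≢ a
      w≢a refl = not-both (HOrBoundaryEdge-source r) w∉H

  private
    phase₁ : Grow₁.Closure OutsideLeaves (singleton G h)
    phase₁ = Grow₁.closure outsideLeaves-preserved (singleton G h)
      λ w w∈ w∉H → ⊥-elim (not-both (subst (_∈V V H) (≡.sym (∈V⁅⁆⁻ w∈)) h∈) w∉H)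

    open Grow₁.Closure phase₁
      renaming (subtree to P₁; invariant to outsideLeaves₁; closed to closed₁; extends to extends₁)

    h∈P₁ : h ∈V vertices P₁
    h∈P₁ = extends₁ h (∈V⁅⁆ h)

    V⊆P₁ : ∀ {w} → w ∈V V H → w ∈V vertices P₁
    V⊆P₁ {w} w∈ =
      Reach-closed {S = vertices P₁} (λ a∈ ab → closed₁ a∈ (inj₁ ab)) h∈P₁ (proj₂ H-conn h w h∈ w∈)

    N⊆P₁ : ∀ {w} → w ∈V NH → w ∈V vertices P₁
    N⊆P₁ {w} w∈ = let _ , a , a∈ , wa = ∈N⁻ {G = G} {S = V H} w∈ in
      closed₁ (V⊆P₁ a∈) (inj₂ (a∈ , w∈ , trans (sym G a w) wa))

    ∣N∣≤leafCount₁ : ∣ NH ∣ ≤ leafCount P₁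
    ∣N∣≤leafCount₁ = subst (_≤ leafCount P₁) (≡.sym (∣p∣≡count NH)) (count-mono N⊆leaves)
      where
      N⊆leaves : lookup NH ⊆ᵇ isLeaf (vertices P₁) (T (tree P₁))
      N⊆leaves w w∈ = cong₂ (λ b d → b ∧ (d ≡ᵇ 1)) (N⊆P₁ w∈)
        (outsideLeaves₁ w (N⊆P₁ w∈) (proj₁ (∈N⁻ {G = G} {S = V H} w∈)))

    phase₂ : Grow₂.Closure (λ P → ∣ NH ∣ ≤ leafCount P) P₁
    phase₂ = Grow₂.closure (λ P a∈ b∉ ab ∣N∣≤ → ≤-trans ∣N∣≤ (Attach.leafCount-mono P a∈ b∉ ab))
      P₁ ∣N∣≤leafCount₁

    open Grow₂.Closure phase₂
      renaming (subtree to P₂; invariant to ∣N∣≤leafCount₂; closed to closed₂; extends to extends₂)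

    C = vertices P₂

    C-component : IsComponent G C
    C-component = (proj₁ (T-conn (tree P₂)) , λ a b a∈ b∈ →
                    Reach-map (λ _ w∈ → w∈) (T⊆E (tree P₂)) (proj₂ (T-conn (tree P₂)) a b a∈ b∈))
                , λ a b a∈ ab → closed₂ a∈ ab

    ∣N∣<∣C∣ : ∣ NH ∣ < ∣ C ∣
    ∣N∣<∣C∣ = subst₂ _<_ (≡.sym (∣p∣≡count NH)) (≡.sym (∣p∣≡count C))
      (count-mono-< (λ w w∈ → extends₂ w (N⊆P₁ w∈)) (∈⇒∉N {G = G} {S = V H} h∈) (extends₂ h h∈P₁))

  ∣N∣≤leaves-of-component-tree :
    Σ (Subset n) λ C → IsComponent G C × Σ (SpanningTree C (adj G)) λ t → ∣ N G (V H) ∣ ≤ leaves t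
  ∣N∣≤leaves-of-component-tree = C , C-component , tree P₂ , ≤-leaves (tree P₂) ∣N∣<∣C∣ ∣N∣≤leafCount₂

lemma2p1 : ∀ (n : ℕ) (G : Graph n) (t : ℕ) → IsComponentMaxLeaf G t →
    (H : Subgraph G) → Connected (V H) (E H) → ∣ N G (V H) ∣ ≤ t
lemma2p1 n G t (_ , maxleaf≤t) H H-conn =
  let C , C-component , tree , ∣N∣≤leaves = ∣N∣≤leaves-of-component-tree G H H-conn
  in decidable-stable (∣ N G (V H) ∣ ≤? t) λ ∣N∣≰t →
       ¬¬-IsMaxLeaf tree λ (m , max@(_ , leaves≤m)) →
         ∣N∣≰t (≤-trans ∣N∣≤leaves (≤-trans (leaves≤m tree) (maxleaf≤t C m C-component max)))
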